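{- Let $J:\mathcal{C}\to\mathcal{D}$, $R:\mathcal{C}\to\mathcal{C}'$, $S:\mathcal{D}\to\mathcal{D}'$, $J':\mathcal{C}'\to\mathcal{D}'$ be functors together with a natural isomorphism $\alpha: S\circ J\cong J'\circ R$. Suppose $S$ preserves pullbacks, $S$ is split full, and $R$ is split essentially surjective. Then for every morphism $p:\tilde U\to U$ in $\mathcal{D}$, there is a function from $J$-universe structures on $p$ to $J'$-universe structures on $S(p)$.
   Context: A functor $S$ is split full if it comes with an operation assigning to each morphism $g:S(a)\to S(b)$ a chosen $h:a\to b$ with $S(h)=g$. A functor $R$ is split essentially surjective if it comes with an operation assigning to each object $c$ of its codomain an object $\bar c$ of its domain and an isomorphism $R(\bar c)\cong c$. Given $J:\mathcal{C}\to\mathcal{D}$, $p:\tilde U\to U$ in $\mathcal{D}$, $X$ in $\mathcal{C}$ and $f:J(X)\to U$, a $J$-pullback of $p$ along $f$ is an object $X'$ of $\mathcal{C}$ with morphisms $p':X'\to X$ and $Q:J(X')\to\tilde U$ such that $Q;p=J(p');f$ (diagrammatic composition) and this square is a pullback in $\mathcal{D}$. A $J$-universe structure on $p$ is a function assigning to every $X$ in $\mathcal{C}$ and $f:J(X)\to U$ a $J$-pullback of $p$ along $f$. -}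

module Defs where

open import Level using (Level; _⊔_; suc)
open import Data.Product using (Σ; _×_; _,_; proj₁; proj₂)
open import Relation.Binary.PropositionalEquality using (_≡_)

-- Categories, with composition written in diagrammatic order (f ⨾ g : first f, then g).
record Category (o h : Level) : Set (suc (o ⊔ h)) where
  infixl 9 _⨾_
  field
    Ob    : Set o
    Hom   : Ob → Ob → Set h
    idm   : (a : Ob) → Hom a a
    _⨾_   : {a b c : Ob} → Hom a b → Hom b c → Hom a c
    idˡ   : {a b : Ob} (f : Hom a b) → idm a ⨾ f ≡ f
    idʳ   : {a b : Ob} (f : Hom a b) → f ⨾ idm b ≡ f
    assoc : {a b c d : Ob} (f : Hom a b) (g : Hom b c) (k : Hom c d) →
            (f ⨾ g) ⨾ k ≡ f ⨾ (g ⨾ k)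

open Category public

record Functor {o₁ h₁ o₂ h₂ : Level} (C : Category o₁ h₁) (D : Category o₂ h₂)
       : Set (o₁ ⊔ h₁ ⊔ o₂ ⊔ h₂) where
  field
    F₀      : Ob C → Ob D
    F₁      : {a b : Ob C} → Hom C a b → Hom D (F₀ a) (F₀ b)
    F-id    : (a : Ob C) → F₁ (idm C a) ≡ idm D (F₀ a)
    F-comp  : {a b c : Ob C} (f : Hom C a b) (g : Hom C b c) →
              F₁ (_⨾_ C f g) ≡ _⨾_ D (F₁ f) (F₁ g)

open Functor public

_∘F_ : {o₁ h₁ o₂ h₂ o₃ h₃ : Level} {C : Category o₁ h₁} {D : Category o₂ h₂}
       {E : Category o₃ h₃} → Functor D E → Functor C D → Functor C E
_∘F_ {C = C} {D} {E} G F = record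
  { F₀ = λ a → F₀ G (F₀ F a)
  ; F₁ = λ f → F₁ G (F₁ F f)
  ; F-id = λ a → trans (cong (F₁ G) (F-id F a)) (F-id G (F₀ F a))
  ; F-comp = λ f g → trans (cong (F₁ G) (F-comp F f g)) (F-comp G (F₁ F f) (F₁ F g))
  }
  where open import Relation.Binary.PropositionalEquality using (trans; cong)

record Iso {o h : Level} (C : Category o h) (a b : Ob C) : Set h where
  field
    to      : Hom C a b
    from    : Hom C b a
    to-from : _⨾_ C to from ≡ idm C a
    from-to : _⨾_ C from to ≡ idm C b

record NatIso {o₁ h₁ o₂ h₂ : Level} {C : Category o₁ h₁} {D : Category o₂ h₂}
       (F G : Functor C D) : Set (o₁ ⊔ h₁ ⊔ h₂) where
  field
    component  : (a : Ob C) → Iso D (F₀ F a) (F₀ G a)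
    naturality : {a b : Ob C} (f : Hom C a b) →
                 _⨾_ D (F₁ F f) (Iso.to (component b)) ≡ _⨾_ D (Iso.to (component a)) (F₁ G f)

IsPullback : {o h : Level} (C : Category o h) {P A B Z : Ob C}
             (p₁ : Hom C P A) (p₂ : Hom C P B) (f : Hom C A Z) (g : Hom C B Z) →
             Set (o ⊔ h)
IsPullback C {P} {A} {B} p₁ p₂ f g =
  (W : Ob C) (a : Hom C W A) (b : Hom C W B) → _⨾_ C a f ≡ _⨾_ C b g →
  Σ (Hom C W P) λ u →
    ((_⨾_ C u p₁ ≡ a) × (_⨾_ C u p₂ ≡ b)) ×
    ((u' : Hom C W P) → _⨾_ C u' p₁ ≡ a → _⨾_ C u' p₂ ≡ b → u' ≡ u)

PreservesPullbacks : {o₁ h₁ o₂ h₂ : Level} {C : Category o₁ h₁} {D : Category o₂ h₂}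
                     (S : Functor C D) → Set (o₁ ⊔ h₁ ⊔ o₂ ⊔ h₂)
PreservesPullbacks {C = C} {D} S =
  {P A B Z : Ob C} (p₁ : Hom C P A) (p₂ : Hom C P B) (f : Hom C A Z) (g : Hom C B Z) →
  _⨾_ C p₁ f ≡ _⨾_ C p₂ g →
  IsPullback C p₁ p₂ f g → IsPullback D (F₁ S p₁) (F₁ S p₂) (F₁ S f) (F₁ S g)

SplitFull : {o₁ h₁ o₂ h₂ : Level} {C : Category o₁ h₁} {D : Category o₂ h₂}
            (S : Functor C D) → Set (o₁ ⊔ h₁ ⊔ h₂)
SplitFull {C = C} {D} S =
  {a b : Ob C} (g : Hom D (F₀ S a) (F₀ S b)) → Σ (Hom C a b) λ k → F₁ S k ≡ g

SplitEssSurj : {o₁ h₁ o₂ h₂ : Level} {C : Category o₁ h₁} {D : Category o₂ h₂}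
               (R : Functor C D) → Set (o₁ ⊔ o₂ ⊔ h₂)
SplitEssSurj {C = C} {D} R = (c : Ob D) → Σ (Ob C) λ c̄ → Iso D (F₀ R c̄) c

record JPullback {o₁ h₁ o₂ h₂ : Level} {C : Category o₁ h₁} {D : Category o₂ h₂}
       (J : Functor C D) {Ũ U : Ob D} (p : Hom D Ũ U) (X : Ob C) (f : Hom D (F₀ J X) U)
       : Set (o₁ ⊔ h₁ ⊔ o₂ ⊔ h₂) where
  field
    X'        : Ob C
    p'        : Hom C X' X
    Q         : Hom D (F₀ J X') Ũ
    commutes  : _⨾_ D Q p ≡ _⨾_ D (F₁ J p') f
    isPullback : IsPullback D Q (F₁ J p') p f

UniverseStructure : {o₁ h₁ o₂ h₂ : Level} {C : Category o₁ h₁} {D : Category o₂ h₂}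
                    (J : Functor C D) {Ũ U : Ob D} (p : Hom D Ũ U) → Set (o₁ ⊔ h₁ ⊔ o₂ ⊔ h₂)
UniverseStructure {C = C} {D} J {Ũ} {U} p =
  (X : Ob C) (f : Hom D (F₀ J X) U) → JPullback J p X f

-- Given Y in C' and f : J'(Y) → S(U), pick Ȳ with R(Ȳ) ≅ Y, so that S(J Ȳ) ≅ J'(R Ȳ) ≅ J'(Y).
-- Split fullness lifts the composite S(J Ȳ) ≅ J'(Y) → S(U) to g : J(Ȳ) → U; the J-pullback
-- X' of p along g is sent by S to a pullback square, and transporting its vertex along
-- α : S(J X') ≅ J'(R X') and its corner along S(J Ȳ) ≅ J'(Y) yields a J'-pullback of S(p) along f.
module Submission where

open import Defs hiding (_⨾_; assoc; idˡ; idʳ)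
open import Level using (Level; _⊔_)
open import Data.Product using (Σ; _×_; _,_; proj₁; proj₂)
open import Relation.Binary.PropositionalEquality

module _ {o h : Level} (C : Category o h) where
  open Category C using (_⨾_; assoc; idˡ; idʳ)
  open Iso

  IsPullbackSquare : {P A B Z : Ob C} → Hom C P A → Hom C P B → Hom C A Z → Hom C B Z → Set (o ⊔ h)
  IsPullbackSquare p₁ p₂ f g = (p₁ ⨾ f ≡ p₂ ⨾ g) × IsPullback C p₁ p₂ f g

  ≅-sym : {a b : Ob C} → Iso C a b → Iso C b a
  ≅-sym i = record { to = from i ; from = to i ; to-from = from-to i ; from-to = to-from i }

  module _ {a b : Ob C} (i : Iso C a b) where

    to-from-cancelʳ : {x : Ob C} (u : Hom C x a) → (u ⨾ to i) ⨾ from i ≡ u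
    to-from-cancelʳ u = trans (assoc _ _ _) (trans (cong (u ⨾_) (to-from i)) (idʳ u))

    from-to-cancelʳ : {x : Ob C} (u : Hom C x b) → (u ⨾ from i) ⨾ to i ≡ u
    from-to-cancelʳ u = trans (assoc _ _ _) (trans (cong (u ⨾_) (from-to i)) (idʳ u))

    to-from-cancelˡ : {y : Ob C} (v : Hom C a y) → to i ⨾ (from i ⨾ v) ≡ v
    to-from-cancelˡ v = trans (sym (assoc _ _ _)) (trans (cong (_⨾ v) (to-from i)) (idˡ v))

    from-to-cancelˡ : {y : Ob C} (v : Hom C b y) → from i ⨾ (to i ⨾ v) ≡ v
    from-to-cancelˡ v = trans (sym (assoc _ _ _)) (trans (cong (_⨾ v) (from-to i)) (idˡ v))

    to-from-cancel-middle : {x y : Ob C} (u : Hom C x a) (v : Hom C a y) →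
                            (u ⨾ to i) ⨾ (from i ⨾ v) ≡ u ⨾ v
    to-from-cancel-middle u v = trans (assoc _ _ _) (cong (u ⨾_) (to-from-cancelˡ v))

  ≅-trans : {a b c : Ob C} → Iso C a b → Iso C b c → Iso C a c
  ≅-trans i j = record
    { to      = to i ⨾ to j
    ; from    = from j ⨾ from i
    ; to-from = trans (to-from-cancel-middle j (to i) (from i)) (to-from i)
    ; from-to = trans (to-from-cancel-middle (≅-sym i) (from j) (to j)) (from-to j)
    }

  module _ {P P' A B Z : Ob C} {p₁ : Hom C P A} {p₂ : Hom C P B} {f : Hom C A Z} {g : Hom C B Z}
           (φ : Iso C P P') where

    pullback-vertex-iso : IsPullbackSquare p₁ p₂ f g →
                          IsPullbackSquare (from φ ⨾ p₁) (from φ ⨾ p₂) f g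
    pullback-vertex-iso (square , universal) = square' , universal'
      where
      open ≡-Reasoning
      square' : (from φ ⨾ p₁) ⨾ f ≡ (from φ ⨾ p₂) ⨾ g
      square' = begin
        (from φ ⨾ p₁) ⨾ f   ≡⟨ assoc _ _ _ ⟩
        from φ ⨾ (p₁ ⨾ f)   ≡⟨ cong (from φ ⨾_) square ⟩
        from φ ⨾ (p₂ ⨾ g)   ≡⟨ sym (assoc _ _ _) ⟩
        (from φ ⨾ p₂) ⨾ g   ∎
      universal' : IsPullback C (from φ ⨾ p₁) (from φ ⨾ p₂) f g
      universal' W a b cone with universal W a b cone
      ... | u , (u₁ , u₂) , unique =
        u ⨾ to φ
        , (trans (to-from-cancel-middle φ u p₁) u₁ , trans (to-from-cancel-middle φ u p₂) u₂)
        , λ v v₁ v₂ → trans (sym (from-to-cancelʳ φ v))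
            (cong (_⨾ to φ) (unique (v ⨾ from φ) (trans (assoc _ _ _) v₁) (trans (assoc _ _ _) v₂)))

  module _ {P A B B' Z : Ob C} {p₁ : Hom C P A} {p₂ : Hom C P B} {f : Hom C A Z} {g : Hom C B Z}
           (ψ : Iso C B B') {g' : Hom C B' Z} (g-factors : g ≡ to ψ ⨾ g') where

    pullback-corner-iso : IsPullbackSquare p₁ p₂ f g →
                          IsPullbackSquare p₁ (p₂ ⨾ to ψ) f g'
    pullback-corner-iso (square , universal) = square' , universal'
      where
      open ≡-Reasoning
      square' : p₁ ⨾ f ≡ (p₂ ⨾ to ψ) ⨾ g'
      square' = begin
        p₁ ⨾ f              ≡⟨ square ⟩
        p₂ ⨾ g              ≡⟨ cong (p₂ ⨾_) g-factors ⟩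
        p₂ ⨾ (to ψ ⨾ g')    ≡⟨ sym (assoc _ _ _) ⟩
        (p₂ ⨾ to ψ) ⨾ g'    ∎
      universal' : IsPullback C p₁ (p₂ ⨾ to ψ) f g'
      universal' W a b cone with universal W a (b ⨾ from ψ) cone'
        where
        cone' : a ⨾ f ≡ (b ⨾ from ψ) ⨾ g
        cone' = begin
          a ⨾ f                        ≡⟨ cone ⟩
          b ⨾ g'                       ≡⟨ sym (cong (b ⨾_) (from-to-cancelˡ ψ g')) ⟩
          b ⨾ (from ψ ⨾ (to ψ ⨾ g'))  ≡⟨ sym (assoc _ _ _) ⟩
          (b ⨾ from ψ) ⨾ (to ψ ⨾ g')  ≡⟨ cong ((b ⨾ from ψ) ⨾_) (sym g-factors) ⟩
          (b ⨾ from ψ) ⨾ g             ∎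
      ... | u , (u₁ , u₂) , unique =
        u , (u₁ , trans (sym (assoc _ _ _)) (trans (cong (_⨾ to ψ) u₂) (from-to-cancelʳ ψ b)))
        , λ v v₁ v₂ → unique v v₁
            (trans (sym (to-from-cancelʳ ψ (v ⨾ p₂)))
                   (cong (_⨾ from ψ) (trans (assoc _ _ _) v₂)))

module _ {o₁ h₁ o₂ h₂ : Level} {C : Category o₁ h₁} {D : Category o₂ h₂} (F : Functor C D) where
  open Category C using () renaming (_⨾_ to _⨾C_)
  open Category D using () renaming (_⨾_ to _⨾D_)

  F-resp-square : {P A B Z : Ob C} {p₁ : Hom C P A} {p₂ : Hom C P B} {f : Hom C A Z} {g : Hom C B Z} →
                  p₁ ⨾C f ≡ p₂ ⨾C g → F₁ F p₁ ⨾D F₁ F f ≡ F₁ F p₂ ⨾D F₁ F g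
  F-resp-square square = trans (sym (F-comp F _ _)) (trans (cong (F₁ F) square) (F-comp F _ _))

  F-resp-pullbackSquare : PreservesPullbacks F →
                          {P A B Z : Ob C} {p₁ : Hom C P A} {p₂ : Hom C P B} {f : Hom C A Z} {g : Hom C B Z} →
                          IsPullbackSquare C p₁ p₂ f g →
                          IsPullbackSquare D (F₁ F p₁) (F₁ F p₂) (F₁ F f) (F₁ F g)
  F-resp-pullbackSquare preserves (square , universal) =
    F-resp-square square , preserves _ _ _ _ square universal

  F-resp-≅ : {a b : Ob C} → Iso C a b → Iso D (F₀ F a) (F₀ F b)
  F-resp-≅ {a} {b} i = record
    { to      = F₁ F (Iso.to i)
    ; from    = F₁ F (Iso.from i)
    ; to-from = trans (sym (F-comp F _ _)) (trans (cong (F₁ F) (Iso.to-from i)) (F-id F a))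
    ; from-to = trans (sym (F-comp F _ _)) (trans (cong (F₁ F) (Iso.from-to i)) (F-id F b))
    }

module _ {o₁ h₁ o₂ h₂ o₃ h₃ o₄ h₄ : Level}
         {C : Category o₁ h₁} {D : Category o₂ h₂} {C' : Category o₃ h₃} {D' : Category o₄ h₄}
         {J : Functor C D} {R : Functor C C'} {S : Functor D D'} {J' : Functor C' D'}
         (α : NatIso (S ∘F J) (J' ∘F R)) where
  open Category C' using () renaming (_⨾_ to _⨾C'_)
  open Category D' using (_⨾_; assoc)
  open Iso
  private
    α[_] : (X : Ob C) → Iso D' (F₀ S (F₀ J X)) (F₀ J' (F₀ R X))
    α[ X ] = NatIso.component α X

  naturality-transport : {X Y : Ob C} {Y' : Ob C'} (h : Hom C X Y) (e : Iso C' (F₀ R Y) Y') →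
                         (from α[ X ] ⨾ F₁ S (F₁ J h)) ⨾ to (≅-trans D' α[ Y ] (F-resp-≅ J' e))
                           ≡ F₁ J' (F₁ R h ⨾C' to e)
  naturality-transport {X} {Y} h e = begin
    (from α[ X ] ⨾ F₁ S (F₁ J h)) ⨾ (to α[ Y ] ⨾ F₁ J' (to e))   ≡⟨ sym (assoc _ _ _) ⟩
    ((from α[ X ] ⨾ F₁ S (F₁ J h)) ⨾ to α[ Y ]) ⨾ F₁ J' (to e)   ≡⟨ cong (_⨾ F₁ J' (to e)) (assoc _ _ _) ⟩
    (from α[ X ] ⨾ (F₁ S (F₁ J h) ⨾ to α[ Y ])) ⨾ F₁ J' (to e)   ≡⟨ cong (λ k → (from α[ X ] ⨾ k) ⨾ F₁ J' (to e)) (NatIso.naturality α h) ⟩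
    (from α[ X ] ⨾ (to α[ X ] ⨾ F₁ J' (F₁ R h))) ⨾ F₁ J' (to e)  ≡⟨ cong (_⨾ F₁ J' (to e)) (from-to-cancelˡ D' α[ X ] _) ⟩
    F₁ J' (F₁ R h) ⨾ F₁ J' (to e)                                 ≡⟨ sym (F-comp J' _ _) ⟩
    F₁ J' (F₁ R h ⨾C' to e)                                       ∎
    where open ≡-Reasoning

mainTheorem7 : {o₁ h₁ o₂ h₂ o₃ h₃ o₄ h₄ : Level}
    {C : Category o₁ h₁} {D : Category o₂ h₂} {C' : Category o₃ h₃} {D' : Category o₄ h₄}
    (J : Functor C D) (R : Functor C C') (S : Functor D D') (J' : Functor C' D') →
    NatIso (S ∘F J) (J' ∘F R) →
    PreservesPullbacks S → SplitFull S → SplitEssSurj R →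
    {Ũ U : Ob D} (p : Hom D Ũ U) →
    UniverseStructure J p → UniverseStructure J' (F₁ S p)
mainTheorem7 {D = D} {C' = C'} {D'} J R S J' α preserves splitFull splitEssSurj {U = U} p universe Y f =
  record { X' = F₀ R X' ; p' = F₁ R p' ⨾C' Iso.to e ; Q = Iso.from α[X'] ⨾ F₁ S Q
         ; commutes = proj₁ square ; isPullback = proj₂ square }
  where
  open Category C' using () renaming (_⨾_ to _⨾C'_)
  open Category D' using (_⨾_)
  Ȳ = proj₁ (splitEssSurj Y)
  e = proj₂ (splitEssSurj Y)
  ψ : Iso D' (F₀ S (F₀ J Ȳ)) (F₀ J' Y)
  ψ = ≅-trans D' (NatIso.component α Ȳ) (F-resp-≅ J' e)
  lift : Σ (Hom D (F₀ J Ȳ) U) λ g → F₁ S g ≡ Iso.to ψ ⨾ f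
  lift = splitFull (Iso.to ψ ⨾ f)
  g = proj₁ lift
  open JPullback (universe Ȳ g)
  α[X'] = NatIso.component α X'
  square : IsPullbackSquare D' (Iso.from α[X'] ⨾ F₁ S Q) (F₁ J' (F₁ R p' ⨾C' Iso.to e)) (F₁ S p) f
  square = subst (λ k → IsPullbackSquare D' (Iso.from α[X'] ⨾ F₁ S Q) k (F₁ S p) f)
                 (naturality-transport {J = J} {R} {S} {J'} α p' e)
    (pullback-corner-iso D' ψ (proj₂ lift)
      (pullback-vertex-iso D' α[X']
        (F-resp-pullbackSquare S preserves (commutes , isPullback))))
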